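{- Let $G$ be a connected graph of order $n\geq 4$ and diameter $D\geq 3$. Let $P$ be a shortest path in $G$ between two vertices at distance $D$, and suppose there is a vertex $u$ on $P$ such that $\mathrm{ecc}(u)$ is strictly larger than the largest distance $L$ from $u$ to an extremity (end vertex) of $P$. Let $v$ be a vertex of $G$ with $\mathrm{dist}(v,u)=\mathrm{ecc}(u)$, and let $v=w_1-w_2-\cdots-w_{\mathrm{ecc}(u)+1}=u$ be a path of length $\mathrm{ecc}(u)$ from $v$ to $u$ in $G$. Then: (i) the vertices $w_1,\ldots,w_{\mathrm{ecc}(u)-L}$ do not belong to $P$; (ii) the vertex $w_{\mathrm{ecc}(u)-L}$ either has no neighbor on $P$, or its unique neighbor on $P$ is an extremity of $P$ at distance $L$ from $u$; (iii) if $\mathrm{ecc}(u)-L>1$, then the vertices $w_1,\ldots,w_{\mathrm{ecc}(u)-L-1}$ have no neighbor on $P$.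
   Context: Graphs are simple, finite, undirected. $\mathrm{dist}(x,y)$ is the length of a shortest $x$–$y$ path, $\mathrm{ecc}(x)=\max_{y}\mathrm{dist}(x,y)$, and the diameter is the maximum eccentricity. -}

module Defs where

open import Level using (0ℓ)
open import Data.Nat using (ℕ; zero; suc; _≤_; _<_)
open import Data.Fin using (Fin; zero; suc; inject₁; fromℕ)
open import Data.Product using (Σ; _×_; ∃)
open import Relation.Nullary using (¬_)
open import Relation.Binary using (Decidable)
open import Relation.Binary.PropositionalEquality using (_≡_)
open import Function.Definitions using (Injective)

record Graph (n : ℕ) : Set₁ where
  field
    Adj     : Fin n → Fin n → Set
    adj?    : Decidable Adj
    sym     : ∀ {x y} → Adj x y → Adj y x
    irrefl  : ∀ {x} → ¬ Adj x x

open Graph public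

IsWalk : ∀ {n} (G : Graph n) {k : ℕ} → (Fin (suc k) → Fin n) → Set
IsWalk G {k} w = (i : Fin k) → Adj G (w (inject₁ i)) (w (suc i))

IsPath : ∀ {n} (G : Graph n) {k : ℕ} → (Fin (suc k) → Fin n) → Set
IsPath G w = IsWalk G w × Injective _≡_ _≡_ w

WalkOfLen : ∀ {n} (G : Graph n) → Fin n → Fin n → ℕ → Set
WalkOfLen {n} G x y k =
  Σ (Fin (suc k) → Fin n) λ w → IsWalk G w × w zero ≡ x × w (fromℕ k) ≡ y

Dist : ∀ {n} (G : Graph n) → Fin n → Fin n → ℕ → Set
Dist G x y k = WalkOfLen G x y k × (∀ m → WalkOfLen G x y m → k ≤ m)

Connected : ∀ {n} (G : Graph n) → Set
Connected G = ∀ x y → ∃ λ k → WalkOfLen G x y k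

Ecc : ∀ {n} (G : Graph n) → Fin n → ℕ → Set
Ecc G u e = (∀ y k → Dist G u y k → k ≤ e) × ∃ λ y → Dist G u y e

Diam : ∀ {n} (G : Graph n) → ℕ → Set
Diam G D = (∀ x e → Ecc G x e → e ≤ D) × ∃ λ x → Ecc G x D

-- Write u = p j. Since P is a geodesic, the subpath of P from any of its vertices to u has
-- length at most L, and strictly less unless that vertex is an extremity at distance L from u.
-- Hence a walk of length m from v to a vertex of P gives ecc(u) = dist(v,u) ≤ m + L, so
-- m ≥ ecc(u) − L, and at equality the vertex reached is such an extremity. Applied to the
-- initial segments of w this gives (i) and (iii), and (ii) up to uniqueness, which holds as
-- the two extremities, at distance D ≥ 3, have no common neighbour.
module Submission where

open import Defs
open import Data.Nat using (ℕ; zero; suc; _≤_; _<_; _∸_; _⊔_; _+_; z≤n; s≤s)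
open import Data.Nat.Properties
open import Data.Fin using (Fin; zero; suc; fromℕ; toℕ)
open import Data.Fin.Properties using (toℕ-fromℕ; toℕ-injective; toℕ≤pred[n])
open import Data.Product using (_×_; _,_; ∃-syntax)
open import Data.Sum using (_⊎_; inj₁; inj₂)
open import Data.Empty using (⊥; ⊥-elim)
open import Function using (_∘_)
open import Relation.Nullary using (¬_)
open import Relation.Binary.PropositionalEquality
  using (_≡_; _≢_; refl; cong; subst; trans) renaming (sym to ≡-sym)

shorter-or-at-start : ∀ {k j a l} → k ≤ j → j ≤ a → a ≤ l → j ∸ k < l ⊎ (k ≡ 0 × a ≡ l)
shorter-or-at-start {zero} _ j≤a a≤l with m≤n⇒m<n∨m≡n a≤l
... | inj₁ a<l = inj₁ (≤-<-trans j≤a a<l)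
... | inj₂ a≡l = inj₂ (refl , a≡l)
shorter-or-at-start {suc k} k<j j≤a a≤l =
  inj₁ (<-≤-trans (∸-monoʳ-< (s≤s z≤n) k<j) (≤-trans j≤a a≤l))

shorter-or-at-end : ∀ {j k d b l} → j ≤ k → k ≤ d → d ∸ j ≤ b → b ≤ l →
  k ∸ j < l ⊎ (k ≡ d × b ≡ l)
shorter-or-at-end j≤k k≤d d∸j≤b b≤l with m≤n⇒m<n∨m≡n k≤d | m≤n⇒m<n∨m≡n b≤l
... | inj₁ k<d  | _        = inj₁ (<-≤-trans (∸-monoˡ-< k<d j≤k) (≤-trans d∸j≤b b≤l))
... | inj₂ refl | inj₁ b<l = inj₁ (≤-<-trans d∸j≤b b<l)
... | inj₂ refl | inj₂ b≡l = inj₂ (refl , b≡l)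

module Walks {n} (G : Graph n) where

  data Walk : Fin n → Fin n → ℕ → Set where
    nil  : ∀ {x} → Walk x x 0
    cons : ∀ {x y z k} → Adj G x y → Walk y z k → Walk x z (suc k)

  _++_ : ∀ {x y z k m} → Walk x y k → Walk y z m → Walk x z (k + m)
  nil       ++ r = r
  cons xy w ++ r = cons xy (w ++ r)

  snoc : ∀ {x y z k} → Walk x y k → Adj G y z → Walk x z (suc k)
  snoc nil         yz = cons yz nil
  snoc (cons xy w) yz = cons xy (snoc w yz)

  reverse : ∀ {x y k} → Walk x y k → Walk y x k
  reverse nil         = nil
  reverse (cons xy w) = snoc (reverse w) (Graph.sym G xy)

  toWalkOfLen : ∀ {x y k} → Walk x y k → WalkOfLen G x y k
  toWalkOfLen (nil {x}) = (λ _ → x) , (λ ()) , refl , refl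
  toWalkOfLen (cons {x} xy w) with toWalkOfLen w
  ... | f , f-walk , refl , f-end =
    (λ { zero → x ; (suc i) → f i }) , (λ { zero → xy ; (suc i) → f-walk i }) , refl , f-end

  fromWalkOfLen : ∀ {x y} k → WalkOfLen G x y k → Walk x y k
  fromWalkOfLen zero    (f , _ , refl , refl)      = nil
  fromWalkOfLen (suc k) (f , f-walk , refl , refl) =
    cons (f-walk zero) (fromWalkOfLen k (f ∘ suc , f-walk ∘ suc , refl , refl))

  Dist⇒Walk : ∀ {x y k} → Dist G x y k → Walk x y k
  Dist⇒Walk (w , _) = fromWalkOfLen _ w

  Dist⇒≤ : ∀ {x y k m} → Dist G x y k → Walk x y m → k ≤ m
  Dist⇒≤ (_ , shortest) w = shortest _ (toWalkOfLen w)

  segment : ∀ {k} {f : Fin (suc k) → Fin n} → IsWalk G f → (i m : Fin (suc k)) →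
    toℕ i ≤ toℕ m → Walk (f i) (f m) (toℕ m ∸ toℕ i)
  segment         f-walk zero    zero    _         = nil
  segment {suc k} f-walk zero    (suc m) _         =
    cons (f-walk zero) (segment (f-walk ∘ suc) zero m z≤n)
  segment {suc k} f-walk (suc i) (suc m) (s≤s i≤m) = segment (f-walk ∘ suc) i m i≤m

  segment-to-end : ∀ {k} {f : Fin (suc k) → Fin n} → IsWalk G f → (i : Fin (suc k)) →
    Walk (f i) (f (fromℕ k)) (k ∸ toℕ i)
  segment-to-end {k} {f} f-walk i =
    subst (λ l → Walk (f i) (f (fromℕ k)) (l ∸ toℕ i)) (toℕ-fromℕ k)
      (segment f-walk i (fromℕ k) (subst (toℕ i ≤_) (≡-sym (toℕ-fromℕ k)) (toℕ≤pred[n] i)))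

  no-common-neighbour : ∀ {x y z D} → Dist G x z D → 3 ≤ D → Adj G y x → Adj G y z → ⊥
  no-common-neighbour xz 3≤D yx yz =
    <⇒≱ (s≤s (s≤s (s≤s z≤n))) (≤-trans 3≤D (Dist⇒≤ xz (cons (Graph.sym G yx) (cons yz nil))))

  module Geodesic {D} (p : Fin (suc D) → Fin n) (p-walk : IsWalk G p)
    (p-geodesic : Dist G (p zero) (p (fromℕ D)) D) where

    geodesic-start-≤ : ∀ {m} (i : Fin (suc D)) → Walk (p i) (p zero) m → toℕ i ≤ m
    geodesic-start-≤ {m} i w = +-cancelʳ-≤ (D ∸ toℕ i) (toℕ i) m
      (subst (_≤ m + (D ∸ toℕ i)) (≡-sym (m+[n∸m]≡n (toℕ≤pred[n] i)))
        (Dist⇒≤ p-geodesic (reverse w ++ segment-to-end p-walk i)))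

    geodesic-end-≤ : ∀ {m} (i : Fin (suc D)) → Walk (p i) (p (fromℕ D)) m → D ∸ toℕ i ≤ m
    geodesic-end-≤ i w =
      m≤n+o⇒m∸n≤o D (toℕ i) (Dist⇒≤ p-geodesic (segment p-walk zero i z≤n ++ w))

    AtEnd : Fin (suc D) → Set
    AtEnd k = p k ≡ p zero ⊎ p k ≡ p (fromℕ D)

    common-neighbour-same-end : ∀ {x k k′} → 3 ≤ D → Adj G x (p k) → Adj G x (p k′) →
      AtEnd k → AtEnd k′ → p k ≡ p k′
    common-neighbour-same-end _ _ _ (inj₁ k₀) (inj₁ k′₀) = trans k₀ (≡-sym k′₀)
    common-neighbour-same-end _ _ _ (inj₂ k₁) (inj₂ k′₁) = trans k₁ (≡-sym k′₁)
    common-neighbour-same-end {x} 3≤D xk xk′ (inj₁ k₀) (inj₂ k′₁) = ⊥-elim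
      (no-common-neighbour p-geodesic 3≤D (subst (Adj G x) k₀ xk) (subst (Adj G x) k′₁ xk′))
    common-neighbour-same-end {x} 3≤D xk xk′ (inj₂ k₁) (inj₁ k′₀) = ⊥-elim
      (no-common-neighbour p-geodesic 3≤D (subst (Adj G x) k′₀ xk′) (subst (Adj G x) k₁ xk))

    module Around (j : Fin (suc D)) {a b} (dist-start : Dist G (p j) (p zero) a)
      (dist-end : Dist G (p j) (p (fromℕ D)) b) where

      L : ℕ
      L = a ⊔ b

      ExtremityAtL : Fin (suc D) → Set
      ExtremityAtL k = (p k ≡ p zero × a ≡ L) ⊎ (p k ≡ p (fromℕ D) × b ≡ L)

      extremity-at-end : ∀ {k} → ExtremityAtL k → AtEnd k
      extremity-at-end (inj₁ (k₀ , _)) = inj₁ k₀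
      extremity-at-end (inj₂ (k₁ , _)) = inj₂ k₁

      extremity-dist : ∀ {k} → ExtremityAtL k → Dist G (p j) (p k) L
      extremity-dist (inj₁ (k₀ , a≡L)) =
        subst (λ x → Dist G (p j) x L) (≡-sym k₀) (subst (Dist G (p j) (p zero)) a≡L dist-start)
      extremity-dist (inj₂ (k₁ , b≡L)) =
        subst (λ x → Dist G (p j) x L) (≡-sym k₁) (subst (Dist G (p j) (p (fromℕ D))) b≡L dist-end)

      closer-than-L-or-extremity : ∀ k → (∃[ d ] d < L × Walk (p k) (p j) d) ⊎ ExtremityAtL k
      closer-than-L-or-extremity k with ≤-total (toℕ k) (toℕ j)
      ... | inj₁ k≤j with shorter-or-at-start k≤j
                            (geodesic-start-≤ j (Dist⇒Walk dist-start)) (m≤m⊔n a b)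
      ...   | inj₁ short       = inj₁ (_ , short , segment p-walk k j k≤j)
      ...   | inj₂ (k≡0 , a≡L) = inj₂ (inj₁ (cong p (toℕ-injective k≡0) , a≡L))
      closer-than-L-or-extremity k | inj₂ j≤k with shorter-or-at-end j≤k (toℕ≤pred[n] k)
                            (geodesic-end-≤ j (Dist⇒Walk dist-end)) (m≤n⊔m a b)
      ...   | inj₁ short       = inj₁ (_ , short , reverse (segment p-walk j k j≤k))
      ...   | inj₂ (k≡D , b≡L) =
        inj₂ (inj₂ (cong p (toℕ-injective (trans k≡D (≡-sym (toℕ-fromℕ D)))) , b≡L))

      within-L : ∀ k → ∃[ d ] d ≤ L × Walk (p k) (p j) d
      within-L k with closer-than-L-or-extremity k
      ... | inj₁ (d , d<L , w) = d , <⇒≤ d<L , w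
      ... | inj₂ ext           = L , ≤-refl , reverse (Dist⇒Walk (extremity-dist ext))

      module FromFarVertex {e v} (dist-v : Dist G v (p j) e) (L≤e : L ≤ e) where

        walk-to-path-≥ : ∀ {m} k → Walk v (p k) m → e ∸ L ≤ m
        walk-to-path-≥ {m} k w with within-L k
        ... | d , d≤L , w′ = m≤n+o⇒m∸n≤o e L (subst (e ≤_) (+-comm m L)
              (≤-trans (Dist⇒≤ dist-v (w ++ w′)) (+-monoʳ-≤ m d≤L)))

        walk-to-path-tight : ∀ {m} k → Walk v (p k) m → m ≡ e ∸ L → ExtremityAtL k
        walk-to-path-tight {m} k w m≡e∸L with closer-than-L-or-extremity k
        ... | inj₂ ext            = ext
        ... | inj₁ (d , d<L , w′) = ⊥-elim (<⇒≱ shortcut (Dist⇒≤ dist-v (w ++ w′)))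
          where
          open ≤-Reasoning
          shortcut : m + d < e
          shortcut = begin-strict
            m + d     <⟨ +-monoʳ-< m d<L ⟩
            m + L     ≡⟨ cong (_+ L) m≡e∸L ⟩
            e ∸ L + L ≡⟨ m∸n+n≡m L≤e ⟩
            e         ∎

lemma1 : ∀ {n} (G : Graph n) → Connected G → 4 ≤ n →
    ∀ D → Diam G D → 3 ≤ D →
    (p : Fin (suc D) → Fin n) → IsPath G p → Dist G (p zero) (p (fromℕ D)) D →
    (j : Fin (suc D)) → (a b e : ℕ) →
    Dist G (p j) (p zero) a → Dist G (p j) (p (fromℕ D)) b →
    Ecc G (p j) e → (a ⊔ b) < e →
    (v : Fin n) → Dist G v (p j) e →
    (w : Fin (suc e) → Fin n) → IsPath G w → w zero ≡ v → w (fromℕ e) ≡ p j →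
    ((i : Fin (suc e)) → toℕ i < e ∸ (a ⊔ b) → ∀ k → w i ≢ p k)
    × ((i : Fin (suc e)) → suc (toℕ i) ≡ e ∸ (a ⊔ b) →
         ((k : Fin (suc D)) → Adj G (w i) (p k) →
            (p k ≡ p zero ⊎ p k ≡ p (fromℕ D)) × Dist G (p j) (p k) (a ⊔ b))
         × ((k k′ : Fin (suc D)) → Adj G (w i) (p k) → Adj G (w i) (p k′) → p k ≡ p k′))
    × (1 < e ∸ (a ⊔ b) →
         (i : Fin (suc e)) → suc (toℕ i) < e ∸ (a ⊔ b) → ∀ k → ¬ Adj G (w i) (p k))
lemma1 G _ _ D _ 3≤D p (p-walk , _) p-geodesic j a b e dist-start dist-end _ L<e
       v dist-v w (w-walk , _) refl _ =
  off-path , last-before-path , λ _ → no-early-neighbour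
  where
  open Walks G
  open Geodesic p p-walk p-geodesic
  open Around j dist-start dist-end
  open FromFarVertex dist-v (<⇒≤ L<e)

  prefix : ∀ i → Walk (w zero) (w i) (toℕ i)
  prefix i = segment w-walk zero i z≤n

  off-path : ∀ i → toℕ i < e ∸ L → ∀ k → w i ≢ p k
  off-path i i<e∸L k wi≡pk =
    <⇒≱ i<e∸L (walk-to-path-≥ k (subst (λ x → Walk (w zero) x (toℕ i)) wi≡pk (prefix i)))

  no-early-neighbour : ∀ i → suc (toℕ i) < e ∸ L → ∀ k → ¬ Adj G (w i) (p k)
  no-early-neighbour i i+1<e∸L k adj = <⇒≱ i+1<e∸L (walk-to-path-≥ k (snoc (prefix i) adj))

  neighbour-is-extremity : ∀ i → suc (toℕ i) ≡ e ∸ L → ∀ k → Adj G (w i) (p k) → ExtremityAtL k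
  neighbour-is-extremity i tight k adj = walk-to-path-tight k (snoc (prefix i) adj) tight

  last-before-path : ∀ i → suc (toℕ i) ≡ e ∸ L →
    (∀ k → Adj G (w i) (p k) → AtEnd k × Dist G (p j) (p k) L)
    × (∀ k k′ → Adj G (w i) (p k) → Adj G (w i) (p k′) → p k ≡ p k′)
  last-before-path i tight =
    (λ k adj → extremity-at-end (at k adj) , extremity-dist (at k adj)) ,
    λ k k′ adj adj′ → common-neighbour-same-end 3≤D adj adj′
                        (extremity-at-end (at k adj)) (extremity-at-end (at k′ adj′))
    where
    at : ∀ k → Adj G (w i) (p k) → ExtremityAtL k
    at = neighbour-is-extremity i tight
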